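{- The total variation mixing time of the Dyck random transposition walk on Dyck paths of length $2n$ is $\Omega(n)$. That is, there exist constants $c>0$ and $n_0$ such that $t_{\mathrm{mix}}\ge c\,n$ for all $n\ge n_0$.
   Context: A Dyck path of length $2n$ is a string $x\in\{+1,-1\}^{2n}$ with $n$ entries $+1$ and $n$ entries $-1$ such that every partial sum $\sum_{i=1}^j x_i$ is nonnegative. The Dyck random transposition walk is the following Markov chain on the set of Dyck paths of length $2n$. From $x$, choose $i,j\in[2n]$ uniformly and independently, swap the entries in positions $i$ and $j$, and move to the result if it is a Dyck path; otherwise stay. Its stationary distribution $\pi$ is uniform. The total variation mixing time is $t_{\mathrm{mix}}=\min\{t:\max_x\|P^t(x,\cdot)-\pi\|_{TV}\le 1/4\}$. -}

module Defs where

open import Data.Bool using (Bool; true; false; _∧_; if_then_else_)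
open import Data.Nat using (ℕ; zero; suc; _*_) renaming (_≡ᵇ_ to _==_)
open import Data.Fin using (Fin)
open import Data.Vec using (Vec; []; _∷_; lookup; _[_]≔_; toList)
open import Data.Vec.Properties using (≡-dec)
open import Data.List using (List; []; _∷_; _++_; map; foldr; allFin; cartesianProduct; filterᵇ; filter; length)
open import Data.Product using (_×_; _,_)
open import Data.Integer using (ℤ; +_)
open import Data.Rational using (ℚ; 0ℚ; 1ℚ; _+_; _-_; _/_; ∣_∣)
import Data.Rational as Q
open import Relation.Nullary using (does)
import Data.Bool.Properties as BP

-- A step of the path: true = +1, false = -1.
-- Paths of length m are vectors Vec Bool m.

allVecs : (m : ℕ) → List (Vec Bool m)
allVecs zero = [] ∷ []
allVecs (suc m) = map (true ∷_) (allVecs m) ++ map (false ∷_) (allVecs m)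

-- dyckFrom h xs : starting at height h (= current partial sum), every partial
-- sum stays nonnegative and the final sum is 0.
dyckFrom : ℕ → List Bool → Bool
dyckFrom h [] = h == 0
dyckFrom h (true ∷ xs) = dyckFrom (suc h) xs
dyckFrom zero (false ∷ xs) = false
dyckFrom (suc h) (false ∷ xs) = dyckFrom h xs

-- x ∈ {±1}^{2n} is a Dyck path: all partial sums ≥ 0 and total sum 0
-- (equivalently n entries +1 and n entries −1, given length 2n).
isDyck : ∀ {m} → Vec Bool m → Bool
isDyck x = dyckFrom 0 (toList x)

DyckPaths : (n : ℕ) → List (Vec Bool (2 * n))
DyckPaths n = filterᵇ isDyck (allVecs (2 * n))

_≟v_ : ∀ {m} (x y : Vec Bool m) → Bool
x ≟v y = does (≡-dec BP._≟_ x y)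

swap : ∀ {m} → Vec Bool m → Fin m → Fin m → Vec Bool m
swap x i j = (x [ i ]≔ lookup x j) [ j ]≔ lookup x i

step : ∀ {m} → Vec Bool m → Fin m → Fin m → Vec Bool m
step x i j = if isDyck (swap x i j) then swap x i j else x

-- 1/k as a rational (with the convention 1/0 = 0, never used for k ≥ 1)
inv : ℕ → ℚ
inv zero = 0ℚ
inv (suc k) = + 1 / suc k

sumℚ : List ℚ → ℚ
sumℚ = foldr _+_ 0ℚ

pairs : (m : ℕ) → List (Fin m × Fin m)
pairs m = cartesianProduct (allFin m) (allFin m)

-- Transition probability P(x,y): (i,j) uniform on [2n]^2
P : (n : ℕ) → Vec Bool (2 * n) → Vec Bool (2 * n) → ℚ
P n x y = (+ length (filterᵇ (λ { (i , j) → step x i j ≟v y }) (pairs (2 * n))) / 1)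
          Q.* inv ((2 * n) * (2 * n))

Pt : (n : ℕ) → ℕ → Vec Bool (2 * n) → Vec Bool (2 * n) → ℚ
Pt n zero x y = if x ≟v y then 1ℚ else 0ℚ
Pt n (suc t) x y = sumℚ (map (λ z → Pt n t x z Q.* P n z y) (DyckPaths n))

π : (n : ℕ) → Vec Bool (2 * n) → ℚ
π n y = inv (length (DyckPaths n))

tv : (n : ℕ) → ℕ → Vec Bool (2 * n) → ℚ
tv n t x = (+ 1 / 2) Q.* sumℚ (map (λ y → ∣ Pt n t x y - π n y ∣) (DyckPaths n))

Mixed : (n : ℕ) → ℕ → Set
Mixed n t = ∀ x → x Data.List.Membership.Propositional.∈ DyckPaths n → tv n t x Q.≤ (+ 1 / 4)
  where import Data.List.Membership.Propositional

-- A move swaps two entries, so after t steps the walk started at x is supported on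
-- the Hamming ball of radius 2t around x.  Weighting the binomial coefficients by
-- powers of 32 shows that this ball has at most (33/32)^(2n) · 32^(2t) points,
-- whereas the number of Dyck paths at least doubles when n grows by 2, so it is at
-- least 2^⌊n/2⌋.  For 128 t < n the ball therefore holds fewer than half of the
-- Dyck paths: P^t(x,·) misses more than half of the uniform mass, and its total
-- variation distance to π exceeds 1/4.

module Submission where

open import Defs
open import Data.Bool using (Bool; true; false; not; T; T?; if_then_else_)
import Data.Bool.Properties as Bool
open import Data.Nat
  using (ℕ; zero; suc; _+_; _*_; _^_; _≤_; _<_; _≤′_; ≤′-refl; ≤′-step; s≤s; s≤s⁻¹; z≤n; _≤?_; NonZero)
open import Data.Nat.Properties
import Data.Nat.DivMod as ℕ
open import Data.Nat.Solver using (module +-*-Solver)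
open import Data.Fin using (Fin)
import Data.Fin as Fin
open import Data.Vec using (Vec; []; _∷_; lookup; _[_]≔_; toList)
open import Data.Vec.Properties using (≡-dec)
open import Data.List using (List; []; _∷_; _++_; map; length; filterᵇ)
open import Data.List.Properties using (filter-none; filter-++; length-++)
import Data.List.Relation.Unary.All as All
open import Data.List.Relation.Unary.Any using (here)
open import Data.List.Relation.Binary.Sublist.Propositional.Properties
  using (filter⁺; filter-⊆; length-mono-≤)
open import Data.List.Membership.Propositional using (_∈_)
open import Data.Product using (Σ; _×_; _,_)
open import Data.Unit using (tt)
open import Data.Integer using (+_; +<+; +≤+)
import Data.Integer as ℤ
import Data.Integer.Properties as ℤ
open import Data.Rational using (ℚ; 0ℚ; 1ℚ; _/_; toℚᵘ; ∣_∣)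
import Data.Rational as ℚ
import Data.Rational.Properties as ℚ
open import Data.Rational.Unnormalised using (mkℚᵘ; *<*; *≤*; *≡*) renaming (_≃_ to _≃ᵘ_)
import Data.Rational.Unnormalised as ℚᵘ
import Data.Rational.Unnormalised.Properties as ℚᵘ
open import Function using (_∘_; id; Equivalence)
open import Relation.Nullary using (¬_; Dec; yes; no)
open import Relation.Nullary.Decidable using (dec-false; decidable-stable)
open import Relation.Binary.PropositionalEquality

open +-*-Solver

count : ∀ {A : Set} → (A → Bool) → List A → ℕ
count p xs = length (filterᵇ p xs)

count-none : ∀ {A : Set} (p : A → Bool) xs → (∀ a → ¬ T (p a)) → count p xs ≡ 0
count-none p xs none = cong length (filter-none (T? ∘ p) (All.universal none xs))

count-++ : ∀ {A : Set} (p : A → Bool) xs ys → count p (xs ++ ys) ≡ count p xs + count p ys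
count-++ p xs ys = trans (cong length (filter-++ (T? ∘ p) xs ys)) (length-++ (filterᵇ p xs))

count-map : ∀ {A B : Set} (p : B → Bool) (f : A → B) xs → count p (map f xs) ≡ count (p ∘ f) xs
count-map p f []       = refl
count-map p f (x ∷ xs) with p (f x)
... | true  = cong suc (count-map p f xs)
... | false = count-map p f xs

count-filterᵇ-≤ : ∀ {A : Set} (p q : A → Bool) xs → count p (filterᵇ q xs) ≤ count p xs
count-filterᵇ-≤ p q xs =
  length-mono-≤ (filter⁺ (T? ∘ p) (T? ∘ p) (λ { refl → id }) (filter-⊆ (T? ∘ q) xs))

count-+-count-not : ∀ {A : Set} (p : A → Bool) xs → count p xs + count (not ∘ p) xs ≡ length xs
count-+-count-not p []       = refl
count-+-count-not p (x ∷ xs) with p x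
... | true  = cong suc (count-+-count-not p xs)
... | false = trans (+-suc _ _) (cong suc (count-+-count-not p xs))

count-allVecs-suc : ∀ {m} (p : Vec Bool (suc m) → Bool) →
  count p (allVecs (suc m)) ≡ count (p ∘ (true ∷_)) (allVecs m) + count (p ∘ (false ∷_)) (allVecs m)
count-allVecs-suc {m} p = trans (count-++ p (map (true ∷_) (allVecs m)) _)
  (cong₂ _+_ (count-map p (true ∷_) (allVecs m)) (count-map p (false ∷_) (allVecs m)))

-- Hamming balls

inHammingBall : ∀ {m} → ℕ → Vec Bool m → Vec Bool m → Bool
inHammingBall k       []          []          = true
inHammingBall k       (true ∷ x)  (true ∷ y)  = inHammingBall k x y
inHammingBall k       (false ∷ x) (false ∷ y) = inHammingBall k x y
inHammingBall zero    (_ ∷ x)     (_ ∷ y)     = false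
inHammingBall (suc k) (_ ∷ x)     (_ ∷ y)     = inHammingBall k x y

inHammingBall-refl : ∀ {m} k (x : Vec Bool m) → T (inHammingBall k x x)
inHammingBall-refl k []          = tt
inHammingBall-refl k (true ∷ x)  = inHammingBall-refl k x
inHammingBall-refl k (false ∷ x) = inHammingBall-refl k x

inHammingBall-suc : ∀ {m} k (x y : Vec Bool m) → T (inHammingBall k x y) → T (inHammingBall (suc k) x y)
inHammingBall-suc k       []          []          p = p
inHammingBall-suc k       (true ∷ x)  (true ∷ y)  p = inHammingBall-suc k x y p
inHammingBall-suc k       (false ∷ x) (false ∷ y) p = inHammingBall-suc k x y p
inHammingBall-suc (suc k) (true ∷ x)  (false ∷ y) p = inHammingBall-suc k x y p
inHammingBall-suc (suc k) (false ∷ x) (true ∷ y)  p = inHammingBall-suc k x y p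

inHammingBall-trans : ∀ {m} a b (x y z : Vec Bool m) →
  T (inHammingBall a x y) → T (inHammingBall b y z) → T (inHammingBall (a + b) x z)
inHammingBall-trans a b [] [] [] p q = tt
inHammingBall-trans a b (true ∷ x) (true ∷ y) (true ∷ z) p q = inHammingBall-trans a b x y z p q
inHammingBall-trans a b (false ∷ x) (false ∷ y) (false ∷ z) p q = inHammingBall-trans a b x y z p q
inHammingBall-trans a (suc b) (true ∷ x) (true ∷ y) (false ∷ z) p q rewrite +-suc a b =
  inHammingBall-trans a b x y z p q
inHammingBall-trans a (suc b) (false ∷ x) (false ∷ y) (true ∷ z) p q rewrite +-suc a b =
  inHammingBall-trans a b x y z p q
inHammingBall-trans (suc a) b (true ∷ x) (false ∷ y) (false ∷ z) p q = inHammingBall-trans a b x y z p q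
inHammingBall-trans (suc a) b (false ∷ x) (true ∷ y) (true ∷ z) p q = inHammingBall-trans a b x y z p q
inHammingBall-trans (suc a) (suc b) (true ∷ x) (false ∷ y) (true ∷ z) p q rewrite +-suc a b =
  inHammingBall-suc (suc (a + b)) x z (inHammingBall-suc (a + b) x z (inHammingBall-trans a b x y z p q))
inHammingBall-trans (suc a) (suc b) (false ∷ x) (true ∷ y) (false ∷ z) p q rewrite +-suc a b =
  inHammingBall-suc (suc (a + b)) x z (inHammingBall-suc (a + b) x z (inHammingBall-trans a b x y z p q))

inHammingBall-update : ∀ {m} (x : Vec Bool m) i v → T (inHammingBall 1 x (x [ i ]≔ v))
inHammingBall-update (true ∷ x)  Fin.zero    true  = inHammingBall-refl 1 x
inHammingBall-update (true ∷ x)  Fin.zero    false = inHammingBall-refl 0 x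
inHammingBall-update (false ∷ x) Fin.zero    true  = inHammingBall-refl 0 x
inHammingBall-update (false ∷ x) Fin.zero    false = inHammingBall-refl 1 x
inHammingBall-update (true ∷ x)  (Fin.suc i) v     = inHammingBall-update x i v
inHammingBall-update (false ∷ x) (Fin.suc i) v     = inHammingBall-update x i v

inHammingBall-swap : ∀ {m} (x : Vec Bool m) i j → T (inHammingBall 2 x (swap x i j))
inHammingBall-swap x i j =
  inHammingBall-trans 1 1 x (x [ i ]≔ lookup x j) (swap x i j)
    (inHammingBall-update x i (lookup x j))
    (inHammingBall-update (x [ i ]≔ lookup x j) j (lookup x i))

inHammingBall-step : ∀ {m} (x : Vec Bool m) i j → T (inHammingBall 2 x (step x i j))
inHammingBall-step x i j with isDyck (swap x i j)
... | true  = inHammingBall-swap x i j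
... | false = inHammingBall-refl 2 x

ballCount : ∀ {m} → ℕ → Vec Bool m → ℕ
ballCount {m} k x = count (inHammingBall k x) (allVecs m)

ballCount-zero-∷ : ∀ {m} b (x : Vec Bool m) → ballCount 0 (b ∷ x) ≡ ballCount 0 x
ballCount-zero-∷ {m} true x =
  trans (count-allVecs-suc (inHammingBall 0 (true ∷ x)))
        (trans (cong (_+_ (ballCount 0 x))
                     (count-none (inHammingBall 0 (true ∷ x) ∘ (false ∷_)) (allVecs m) λ _ ()))
               (+-identityʳ (ballCount 0 x)))
ballCount-zero-∷ {m} false x =
  trans (count-allVecs-suc (inHammingBall 0 (false ∷ x)))
        (cong (_+ ballCount 0 x) (count-none (inHammingBall 0 (false ∷ x) ∘ (true ∷_)) (allVecs m) λ _ ()))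

ballCount-suc-∷ : ∀ {m} k b (x : Vec Bool m) → ballCount (suc k) (b ∷ x) ≡ ballCount (suc k) x + ballCount k x
ballCount-suc-∷ k true  x = count-allVecs-suc (inHammingBall (suc k) (true ∷ x))
ballCount-suc-∷ k false x =
  trans (count-allVecs-suc (inHammingBall (suc k) (false ∷ x))) (+-comm (ballCount k x) (ballCount (suc k) x))

ballCount-bound-step₀ : ∀ d a X E → a * X ≤ E * 1 → a * (d * X) ≤ suc d * E * 1
ballCount-bound-step₀ d a X E h = begin
  a * (d * X)          ≡⟨ solve 3 (λ d a X → a :* (d :* X) := d :* (a :* X)) refl d a X ⟩
  d * (a * X)          ≤⟨ *-monoʳ-≤ d h ⟩
  d * (E * 1)          ≤⟨ m≤n+m _ (E * 1) ⟩
  E * 1 + d * (E * 1)  ≡⟨ solve 2 (λ d E → E :* con 1 :+ d :* (E :* con 1)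
                                         := (con 1 :+ d) :* E :* con 1) refl d E ⟩
  suc d * E * 1        ∎
  where open ≤-Reasoning

ballCount-bound-step : ∀ d a b X Y E →
  a * X ≤ E * (d * Y) → b * X ≤ E * Y → (a + b) * (d * X) ≤ suc d * E * (d * Y)
ballCount-bound-step d a b X Y E ha hb = begin
  (a + b) * (d * X)
    ≡⟨ solve 4 (λ d a b X → (a :+ b) :* (d :* X) := d :* (a :* X) :+ d :* (b :* X)) refl d a b X ⟩
  d * (a * X) + d * (b * X)
    ≤⟨ +-mono-≤ (*-monoʳ-≤ d ha) (*-monoʳ-≤ d hb) ⟩
  d * (E * (d * Y)) + d * (E * Y)
    ≡⟨ solve 3 (λ d E Y → d :* (E :* (d :* Y)) :+ d :* (E :* Y) := (con 1 :+ d) :* E :* (d :* Y)) refl d E Y ⟩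
  suc d * E * (d * Y)
    ∎
  where open ≤-Reasoning

-- Σ_{j ≤ k} C(m,j) ≤ Σ_j C(m,j) d^(k-j) = (d+1)^m d^(k-m); the induction follows Pascal's rule.
ballCount-bound : ∀ {m} d .{{_ : NonZero d}} k (x : Vec Bool m) → ballCount k x * d ^ m ≤ suc d ^ m * d ^ k
ballCount-bound d k [] = *-monoʳ-≤ 1 (m^n>0 d k)
ballCount-bound {suc m} d zero (b ∷ x) rewrite ballCount-zero-∷ b x =
  ballCount-bound-step₀ d (ballCount 0 x) (d ^ m) (suc d ^ m) (ballCount-bound d zero x)
ballCount-bound {suc m} d (suc k) (b ∷ x) rewrite ballCount-suc-∷ k b x =
  ballCount-bound-step d (ballCount (suc k) x) (ballCount k x) (d ^ m) (d ^ k) (suc d ^ m)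
    (ballCount-bound d (suc k) x) (ballCount-bound d k x)

-- Counting Dyck paths

dyckCount : ℕ → ℕ → ℕ
dyckCount h m = count (λ (y : Vec Bool m) → dyckFrom h (toList y)) (allVecs m)

dyckCount-zero-suc : ∀ m → dyckCount 0 (suc m) ≡ dyckCount 1 m
dyckCount-zero-suc m =
  trans (count-allVecs-suc {m} (λ y → dyckFrom 0 (toList y)))
        (trans (cong (_+_ (dyckCount 1 m)) (count-none (λ y → dyckFrom 0 (false ∷ toList y)) (allVecs m) λ _ ()))
               (+-identityʳ (dyckCount 1 m)))

dyckCount-suc-suc : ∀ h m → dyckCount (suc h) (suc m) ≡ dyckCount (suc (suc h)) m + dyckCount h m
dyckCount-suc-suc h m = count-allVecs-suc {m} (λ y → dyckFrom (suc h) (toList y))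

dyckCount-down : ∀ h m → dyckCount h m ≤ dyckCount (suc h) (suc m)
dyckCount-down h m rewrite dyckCount-suc-suc h m = m≤n+m _ _

dyckCount-double : ∀ m → 2 * dyckCount 0 m ≤ dyckCount 0 (4 + m)
dyckCount-double m = begin
  2 * dyckCount 0 m                          ≡⟨ cong (_+_ (dyckCount 0 m)) (+-identityʳ _) ⟩
  dyckCount 0 m + dyckCount 0 m              ≤⟨ +-mono-≤ two-ups up-down ⟩
  dyckCount 2 (2 + m) + dyckCount 0 (2 + m)  ≡⟨ dyckCount-suc-suc 0 (2 + m) ⟨
  dyckCount 1 (3 + m)                        ≡⟨ dyckCount-zero-suc (3 + m) ⟨
  dyckCount 0 (4 + m)                        ∎
  where
  open ≤-Reasoning
  two-ups : dyckCount 0 m ≤ dyckCount 2 (2 + m)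
  two-ups = ≤-trans (dyckCount-down 0 m) (dyckCount-down 1 (suc m))
  up-down : dyckCount 0 m ≤ dyckCount 0 (2 + m)
  up-down = ≤-trans (dyckCount-down 0 m) (≤-reflexive (sym (dyckCount-zero-suc (suc m))))

dyckCount-even-positive : ∀ r → 0 < dyckCount 0 (2 * r)
dyckCount-even-positive zero    = s≤s z≤n
dyckCount-even-positive (suc r) = begin
  1                         ≤⟨ dyckCount-even-positive r ⟩
  dyckCount 0 (2 * r)       ≤⟨ dyckCount-down 0 (2 * r) ⟩
  dyckCount 1 (suc (2 * r)) ≡⟨ dyckCount-zero-suc (suc (2 * r)) ⟨
  dyckCount 0 (2 + 2 * r)   ≡⟨ cong (dyckCount 0) (*-suc 2 r) ⟨
  dyckCount 0 (2 * suc r)   ∎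
  where open ≤-Reasoning

dyckCount-pow2 : ∀ q m → 2 ^ q * dyckCount 0 m ≤ dyckCount 0 (4 * q + m)
dyckCount-pow2 zero    m = ≤-reflexive (+-identityʳ _)
dyckCount-pow2 (suc q) m = begin
  2 * 2 ^ q * dyckCount 0 m      ≡⟨ *-assoc 2 (2 ^ q) _ ⟩
  2 * (2 ^ q * dyckCount 0 m)    ≤⟨ *-monoʳ-≤ 2 (dyckCount-pow2 q m) ⟩
  2 * dyckCount 0 (4 * q + m)    ≤⟨ dyckCount-double (4 * q + m) ⟩
  dyckCount 0 (4 + (4 * q + m))  ≡⟨ cong (dyckCount 0) (solve 2 (λ q m → con 4 :+ (con 4 :* q :+ m)
                                                                    := con 4 :* (con 1 :+ q) :+ m) refl q m) ⟩
  dyckCount 0 (4 * suc q + m)    ∎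
  where open ≤-Reasoning

length-DyckPaths-≥ : ∀ q r → 2 ^ q ≤ length (DyckPaths (2 * q + r))
length-DyckPaths-≥ q r = begin
  2 ^ q                          ≡⟨ *-identityʳ _ ⟨
  2 ^ q * 1                      ≤⟨ *-monoʳ-≤ (2 ^ q) (dyckCount-even-positive r) ⟩
  2 ^ q * dyckCount 0 (2 * r)    ≤⟨ dyckCount-pow2 q (2 * r) ⟩
  dyckCount 0 (4 * q + 2 * r)    ≡⟨ cong (dyckCount 0) (solve 2 (λ q r → con 4 :* q :+ con 2 :* r
                                                                   := con 2 :* (con 2 :* q :+ r)) refl q r) ⟩
  dyckCount 0 (2 * (2 * q + r))  ∎
  where open ≤-Reasoning

-- Support of the walk

≟v-sound : ∀ {m} (x y : Vec Bool m) → T (x ≟v y) → x ≡ y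
≟v-sound x y p with ≡-dec Bool._≟_ x y
... | yes x≡y = x≡y

P-unreachable : ∀ n x y → (∀ i j → step x i j ≢ y) → P n x y ≡ 0ℚ
P-unreachable n x y unreachable =
  trans (cong (λ k → (+ k / 1) ℚ.* inv (2 * n * (2 * n))) (count-none _ (pairs (2 * n)) noMove))
        (ℚ.*-zeroˡ (inv (2 * n * (2 * n))))
  where
  noMove : ∀ ((i , j) : Fin (2 * n) × Fin (2 * n)) → ¬ T (step x i j ≟v y)
  noMove (i , j) = unreachable i j ∘ ≟v-sound _ _

sumℚ-zero : ∀ {A : Set} (f : A → ℚ) (xs : List A) → (∀ a → f a ≡ 0ℚ) → sumℚ (map f xs) ≡ 0ℚ
sumℚ-zero f []       f≡0 = refl
sumℚ-zero f (a ∷ xs) f≡0 rewrite f≡0 a | sumℚ-zero f xs f≡0 = refl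

Pt-outsideBall : ∀ n t x y → ¬ T (inHammingBall (2 * t) x y) → Pt n t x y ≡ 0ℚ
Pt-outsideBall n zero x y y∉ = cong (if_then 1ℚ else 0ℚ) (dec-false (≡-dec Bool._≟_ x y) x≢y)
  where
  x≢y : x ≢ y
  x≢y refl = y∉ (inHammingBall-refl 0 x)
Pt-outsideBall n (suc t) x y y∉ = sumℚ-zero _ (DyckPaths n) (λ z → byDistance z (T? (inHammingBall (2 * t) x z)))
  where
  byDistance : ∀ z → Dec (T (inHammingBall (2 * t) x z)) → Pt n t x z ℚ.* P n z y ≡ 0ℚ
  byDistance z (no z∉)  = trans (cong (ℚ._* P n z y) (Pt-outsideBall n t x z z∉)) (ℚ.*-zeroˡ (P n z y))
  byDistance z (yes z∈) = trans (cong (Pt n t x z ℚ.*_) (P-unreachable n z y farFromZ)) (ℚ.*-zeroʳ (Pt n t x z))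
    where
    farFromZ : ∀ i j → step z i j ≢ y
    farFromZ i j refl = y∉ (subst (λ r → T (inHammingBall r x y)) (trans (+-comm (2 * t) 2) (sym (*-suc 2 t)))
                                  (inHammingBall-trans (2 * t) 2 x z y z∈ (inHammingBall-step z i j)))

toℚᵘ-/ : ∀ a b → toℚᵘ (+ a / suc b) ≃ᵘ mkℚᵘ (+ a) b
toℚᵘ-/ a b = ℚ.toℚᵘ-fromℚᵘ (mkℚᵘ (+ a) b)

/-* : ∀ a b c d → (+ a / suc b) ℚ.* (+ c / suc d) ≡ + (a * c) / (suc b * suc d)
/-* a b c d = ℚ.toℚᵘ-injective (begin
  toℚᵘ ((+ a / suc b) ℚ.* (+ c / suc d))       ≈⟨ ℚ.toℚᵘ-homo-* (+ a / suc b) (+ c / suc d) ⟩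
  toℚᵘ (+ a / suc b) ℚᵘ.* toℚᵘ (+ c / suc d)   ≈⟨ ℚᵘ.*-cong (toℚᵘ-/ a b) (toℚᵘ-/ c d) ⟩
  mkℚᵘ (+ a ℤ.* + c) (d + b * suc d)           ≡⟨ cong (λ n → mkℚᵘ n (d + b * suc d)) (ℤ.pos-* a c) ⟨
  mkℚᵘ (+ (a * c)) (d + b * suc d)             ≈⟨ toℚᵘ-/ (a * c) (d + b * suc d) ⟨
  toℚᵘ (+ (a * c) / (suc b * suc d))           ∎)
  where open ℚᵘ.≃-Reasoning

/1-suc : ∀ k → + suc k / 1 ≡ 1ℚ ℚ.+ + k / 1
/1-suc k = ℚ.toℚᵘ-injective (begin
  toℚᵘ (+ suc k / 1)                 ≈⟨ toℚᵘ-/ (suc k) 0 ⟩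
  mkℚᵘ (+ suc k) 0                   ≈⟨ *≡* (cong (ℤ._* + 1) (cong (ℤ._+_ (+ 1)) (ℤ.*-identityʳ (+ k)))) ⟨
  mkℚᵘ (+ 1) 0 ℚᵘ.+ mkℚᵘ (+ k) 0     ≈⟨ ℚᵘ.+-cong (ℚᵘ.≃-refl {toℚᵘ 1ℚ}) (toℚᵘ-/ k 0) ⟨
  toℚᵘ 1ℚ ℚᵘ.+ toℚᵘ (+ k / 1)        ≈⟨ ℚ.toℚᵘ-homo-+ 1ℚ (+ k / 1) ⟨
  toℚᵘ (1ℚ ℚ.+ + k / 1)              ∎)
  where open ℚᵘ.≃-Reasoning

/-< : ∀ a b c d → a * suc d < c * suc b → + a / suc b ℚ.< + c / suc d
/-< a b c d h = ℚ.toℚᵘ-cancel-<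
  (ℚᵘ.<-respˡ-≃ (ℚᵘ.≃-sym (toℚᵘ-/ a b)) (ℚᵘ.<-respʳ-≃ (ℚᵘ.≃-sym (toℚᵘ-/ c d))
    (*<* (subst₂ ℤ._<_ (ℤ.pos-* a (suc d)) (ℤ.pos-* c (suc b)) (+<+ h)))))

/-≤ : ∀ a b c d → a * suc d ≤ c * suc b → + a / suc b ℚ.≤ + c / suc d
/-≤ a b c d h = ℚ.toℚᵘ-cancel-≤
  (ℚᵘ.≤-respˡ-≃ (ℚᵘ.≃-sym (toℚᵘ-/ a b)) (ℚᵘ.≤-respʳ-≃ (ℚᵘ.≃-sym (toℚᵘ-/ c d))
    (*≤* (subst₂ ℤ._≤_ (ℤ.pos-* a (suc d)) (ℤ.pos-* c (suc b)) (+≤+ h)))))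

inv-nonNeg : ∀ k → 0ℚ ℚ.≤ inv k
inv-nonNeg zero    = ℚ.≤-refl
inv-nonNeg (suc k) = ℚ.nonNegative⁻¹ _ {{ℚ.normalize-nonNeg 1 (suc k)}}

quarter<half-of : ∀ F N → 0 < N → N < F + F → + 1 / 4 ℚ.< + 1 / 2 ℚ.* ((+ F / 1) ℚ.* inv N)
quarter<half-of F (suc N) _ N<2F = ℚ.*-monoʳ-<-pos (+ 1 / 2) half<
  where
  half< : + 1 / 2 ℚ.< (+ F / 1) ℚ.* (+ 1 / suc N)
  half< rewrite /-* F 0 1 N = /-< 1 1 (F * 1) _ (begin-strict
    1 * (1 * suc N)  ≡⟨ solve 1 (λ n → con 1 :* (con 1 :* n) := n) refl (suc N) ⟩
    suc N            <⟨ N<2F ⟩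
    F + F            ≡⟨ solve 1 (λ f → f :+ f := f :* con 1 :* con 2) refl F ⟩
    F * 1 * 2        ∎)
    where open ≤-Reasoning

n≤128t⇒n/128≤t : ∀ n t → n ≤ 128 * t → + 1 / 128 ℚ.* (+ n / 1) ℚ.≤ + t / 1
n≤128t⇒n/128≤t n t n≤128t rewrite /-* 1 127 n 0 = /-≤ (1 * n) _ t 0 (begin
  1 * n * 1  ≡⟨ solve 1 (λ n → con 1 :* n :* con 1 := n) refl n ⟩
  n          ≤⟨ n≤128t ⟩
  128 * t    ≡⟨ *-comm 128 t ⟩
  t * 128    ∎)
  where open ≤-Reasoning

-- Total variation distance from the escaped mass

count*c≤sumℚ : ∀ {A : Set} (p : A → Bool) (f : A → ℚ) c xs →
  (∀ a → 0ℚ ℚ.≤ f a) → (∀ a → T (p a) → f a ≡ c) → (+ count p xs / 1) ℚ.* c ℚ.≤ sumℚ (map f xs)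
count*c≤sumℚ p f c []       f≥0 f≡c = ℚ.≤-reflexive (ℚ.*-zeroˡ c)
count*c≤sumℚ p f c (a ∷ xs) f≥0 f≡c with p a | f≡c a
... | true  | fa≡c = begin
  (+ suc k / 1) ℚ.* c               ≡⟨ cong (ℚ._* c) (/1-suc k) ⟩
  (1ℚ ℚ.+ + k / 1) ℚ.* c            ≡⟨ ℚ.*-distribʳ-+ c 1ℚ (+ k / 1) ⟩
  1ℚ ℚ.* c ℚ.+ (+ k / 1) ℚ.* c      ≡⟨ cong (ℚ._+ (+ k / 1) ℚ.* c) (ℚ.*-identityˡ c) ⟩
  c ℚ.+ (+ k / 1) ℚ.* c             ≤⟨ ℚ.+-mono-≤ (ℚ.≤-reflexive (sym (fa≡c tt)))
                                                  (count*c≤sumℚ p f c xs f≥0 f≡c) ⟩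
  f a ℚ.+ sumℚ (map f xs)           ∎
  where
  open ℚ.≤-Reasoning
  k = count p xs
... | false | _ = begin
  (+ count p xs / 1) ℚ.* c           ≡⟨ ℚ.+-identityˡ _ ⟨
  0ℚ ℚ.+ (+ count p xs / 1) ℚ.* c    ≤⟨ ℚ.+-mono-≤ (f≥0 a) (count*c≤sumℚ p f c xs f≥0 f≡c) ⟩
  f a ℚ.+ sumℚ (map f xs)            ∎
  where open ℚ.≤-Reasoning

tv-≥-escaped : ∀ n t x →
  + 1 / 2 ℚ.* ((+ count (not ∘ inHammingBall (2 * t) x) (DyckPaths n) / 1) ℚ.* inv (length (DyckPaths n)))
    ℚ.≤ tv n t x
tv-≥-escaped n t x =
  ℚ.*-monoˡ-≤-nonNeg (+ 1 / 2) (count*c≤sumℚ _ _ c (DyckPaths n) (λ y → ℚ.0≤∣p∣ _) escaped)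
  where
  c = inv (length (DyckPaths n))
  escaped : ∀ y → T (not (inHammingBall (2 * t) x y)) → ∣ Pt n t x y ℚ.- π n y ∣ ≡ c
  escaped y y∉ = begin
    ∣ Pt n t x y ℚ.- c ∣  ≡⟨ cong (λ z → ∣ z ℚ.- c ∣)
                                  (Pt-outsideBall n t x y (subst T (Equivalence.to Bool.T-not-≡ y∉))) ⟩
    ∣ 0ℚ ℚ.- c ∣          ≡⟨ cong ∣_∣ (ℚ.+-identityˡ (ℚ.- c)) ⟩
    ∣ ℚ.- c ∣             ≡⟨ ℚ.∣-p∣≡∣p∣ c ⟩
    ∣ c ∣                 ≡⟨ ℚ.0≤p⇒∣p∣≡p (inv-nonNeg (length (DyckPaths n))) ⟩
    c                     ∎
    where open ≡-Reasoning

-- The exponential comparison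

^-split : ∀ b c k q → b ^ (c * (k + q)) ≡ b ^ (c * k) * b ^ (c * q)
^-split b c k q = trans (cong (b ^_) (*-distribˡ-+ c k q)) (^-distribˡ-+-* b (c * k) (c * q))

-- Opaque because comparing two unfolded instances would expand powers such as 33 ^ (4 * (32 + q)).
opaque
  Gap : ℕ → ℕ → Set
  Gap t q = 4 * 33 ^ (4 * q) * 32 ^ (2 * t) < 2 ^ q * 32 ^ (4 * q)

opaque
  unfolding Gap

  gap-step : ∀ j k {t q} → 33 ^ (4 * k) * 32 ^ (2 * j) ≤ 2 ^ k * 32 ^ (4 * k) → Gap t q → Gap (j + t) (k + q)
  gap-step j k {t} {q} growth below = begin-strict
    4 * 33 ^ (4 * (k + q)) * 32 ^ (2 * (j + t))
      ≡⟨ cong₂ (λ a b → 4 * a * b) (^-split 33 4 k q) (^-split 32 2 j t) ⟩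
    4 * (33 ^ (4 * k) * 33 ^ (4 * q)) * (32 ^ (2 * j) * 32 ^ (2 * t))
      ≡⟨ solve 4 (λ a b c d → con 4 :* (a :* b) :* (c :* d) := (a :* c) :* (con 4 :* b :* d)) refl
           (33 ^ (4 * k)) (33 ^ (4 * q)) (32 ^ (2 * j)) (32 ^ (2 * t)) ⟩
    33 ^ (4 * k) * 32 ^ (2 * j) * (4 * 33 ^ (4 * q) * 32 ^ (2 * t))
      ≤⟨ *-monoˡ-≤ _ growth ⟩
    2 ^ k * 32 ^ (4 * k) * (4 * 33 ^ (4 * q) * 32 ^ (2 * t))
      <⟨ *-monoʳ-< _ {{m*n≢0 _ _ {{m^n≢0 2 k}} {{m^n≢0 32 (4 * k)}}}} below ⟩
    2 ^ k * 32 ^ (4 * k) * (2 ^ q * 32 ^ (4 * q))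
      ≡⟨ solve 4 (λ a b c d → a :* b :* (c :* d) := (a :* c) :* (b :* d)) refl
           (2 ^ k) (32 ^ (4 * k)) (2 ^ q) (32 ^ (4 * q)) ⟩
    2 ^ k * 2 ^ q * (32 ^ (4 * k) * 32 ^ (4 * q))
      ≡⟨ cong₂ _*_ (sym (^-distribˡ-+-* 2 k q)) (sym (^-split 32 4 k q)) ⟩
    2 ^ (k + q) * 32 ^ (4 * (k + q))
      ∎
    where open ≤-Reasoning

  gap-base : Gap 0 4
  gap-base = ≤ᵇ⇒≤ _ _ tt

gap-diagonal : ∀ t → Gap t (32 * t + 4)
gap-diagonal zero    = gap-base
gap-diagonal (suc t) =
  subst (Gap (suc t)) (trans (sym (+-assoc 32 (32 * t) 4)) (cong (_+ 4) (sym (*-suc 32 t))))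
        (gap-step 1 32 (≤ᵇ⇒≤ _ _ tt) (gap-diagonal t))

gap : ∀ t q → 32 * t + 4 ≤′ q → Gap t q
gap t _ ≤′-refl       = gap-diagonal t
gap t _ (≤′-step q≥) = gap-step 0 1 (≤ᵇ⇒≤ _ _ tt) (gap t _ q≥)

opaque
  unfolding Gap

  exponential-gap : ∀ t q → 32 * t + 4 ≤ q → 4 * 33 ^ (4 * q) * 32 ^ (2 * t) < 2 ^ q * 32 ^ (4 * q)
  exponential-gap t q h = gap t q (≤⇒≤′ h)

parity-factor-≤ : ∀ r → r ≤ 1 → 2 * 33 ^ (2 * r) ≤ 4 * 32 ^ (2 * r)
parity-factor-≤ 0             _        = ≤ᵇ⇒≤ _ _ tt
parity-factor-≤ 1             _        = ≤ᵇ⇒≤ _ _ tt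
parity-factor-≤ (suc (suc r)) (s≤s ())

ballBound<dyckBound : ∀ t q r → r ≤ 1 → 32 * t + 4 ≤ q →
  2 * 33 ^ (2 * (2 * q + r)) * 32 ^ (2 * t) < 2 ^ q * 32 ^ (2 * (2 * q + r))
ballBound<dyckBound t q r r≤1 q≥ = begin-strict
  2 * 33 ^ (2 * (2 * q + r)) * 32 ^ (2 * t)
    ≡⟨ cong (λ e → 2 * 33 ^ e * 32 ^ (2 * t)) 2n≡ ⟩
  2 * 33 ^ (4 * q + 2 * r) * 32 ^ (2 * t)
    ≡⟨ cong (λ a → 2 * a * 32 ^ (2 * t)) (^-distribˡ-+-* 33 (4 * q) (2 * r)) ⟩
  2 * (33 ^ (4 * q) * 33 ^ (2 * r)) * 32 ^ (2 * t)
    ≡⟨ solve 3 (λ a b c → con 2 :* (a :* b) :* c := (con 2 :* b) :* (a :* c)) refl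
         (33 ^ (4 * q)) (33 ^ (2 * r)) (32 ^ (2 * t)) ⟩
  2 * 33 ^ (2 * r) * (33 ^ (4 * q) * 32 ^ (2 * t))
    ≤⟨ *-monoˡ-≤ _ (parity-factor-≤ r r≤1) ⟩
  4 * 32 ^ (2 * r) * (33 ^ (4 * q) * 32 ^ (2 * t))
    ≡⟨ solve 3 (λ a b c → con 4 :* b :* (a :* c) := b :* (con 4 :* a :* c)) refl
         (33 ^ (4 * q)) (32 ^ (2 * r)) (32 ^ (2 * t)) ⟩
  32 ^ (2 * r) * (4 * 33 ^ (4 * q) * 32 ^ (2 * t))
    <⟨ *-monoʳ-< _ {{m^n≢0 32 (2 * r)}} (exponential-gap t q q≥) ⟩
  32 ^ (2 * r) * (2 ^ q * 32 ^ (4 * q))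
    ≡⟨ solve 3 (λ a b c → b :* (a :* c) := a :* (c :* b)) refl (2 ^ q) (32 ^ (2 * r)) (32 ^ (4 * q)) ⟩
  2 ^ q * (32 ^ (4 * q) * 32 ^ (2 * r))
    ≡⟨ cong (2 ^ q *_) (^-distribˡ-+-* 32 (4 * q) (2 * r)) ⟨
  2 ^ q * 32 ^ (4 * q + 2 * r)
    ≡⟨ cong (λ e → 2 ^ q * 32 ^ e) 2n≡ ⟨
  2 ^ q * 32 ^ (2 * (2 * q + r))
    ∎
  where
  open ≤-Reasoning
  2n≡ : 2 * (2 * q + r) ≡ 4 * q + 2 * r
  2n≡ = solve 2 (λ q r → con 2 :* (con 2 :* q :+ r) := con 4 :* q :+ con 2 :* r) refl q r

ballCount-small : ∀ t q r (x : Vec Bool (2 * (2 * q + r))) → r ≤ 1 → 32 * t + 4 ≤ q →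
                  2 * ballCount (2 * t) x < 2 ^ q
ballCount-small t q r x r≤1 q≥ = *-cancelʳ-< _ _ _ (begin-strict
  2 * ballCount (2 * t) x * 32 ^ m    ≡⟨ *-assoc 2 (ballCount (2 * t) x) (32 ^ m) ⟩
  2 * (ballCount (2 * t) x * 32 ^ m)  ≤⟨ *-monoʳ-≤ 2 (ballCount-bound 32 (2 * t) x) ⟩
  2 * (33 ^ m * 32 ^ (2 * t))         ≡⟨ *-assoc 2 (33 ^ m) (32 ^ (2 * t)) ⟨
  2 * 33 ^ m * 32 ^ (2 * t)           <⟨ ballBound<dyckBound t q r r≤1 q≥ ⟩
  2 ^ q * 32 ^ m                      ∎)
  where
  open ≤-Reasoning
  m = 2 * (2 * q + r)


complement-majority : ∀ a b n → a + b ≡ n → 2 * a < n → n < b + b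
complement-majority a b n a+b≡n 2a<n = +-cancelˡ-< n n (b + b) (begin-strict
  n + n              ≡⟨ cong₂ _+_ (sym a+b≡n) (sym a+b≡n) ⟩
  (a + b) + (a + b)  ≡⟨ solve 2 (λ a b → (a :+ b) :+ (a :+ b) := con 2 :* a :+ (b :+ b)) refl a b ⟩
  2 * a + (b + b)    <⟨ +-monoˡ-< (b + b) 2a<n ⟩
  n + (b + b)        ∎)
  where open ≤-Reasoning

short-walk-far-from-uniform : ∀ t q r → r ≤ 1 → 32 * t + 4 ≤ q → ∀ x →
                              + 1 / 4 ℚ.< tv (2 * q + r) t x
short-walk-far-from-uniform t q r r≤1 q≥ x =
  ℚ.<-≤-trans (quarter<half-of F N 0<N N<2F) (tv-≥-escaped n t x)
  where
  n = 2 * q + r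
  D = DyckPaths n
  N = length D
  inside = count (inHammingBall (2 * t) x) D
  F = count (not ∘ inHammingBall (2 * t) x) D
  2^q≤N : 2 ^ q ≤ N
  2^q≤N = length-DyckPaths-≥ q r
  0<N : 0 < N
  0<N = ≤-trans (m^n>0 2 q) 2^q≤N
  2inside<N : 2 * inside < N
  2inside<N = ≤-<-trans (*-monoʳ-≤ 2 (count-filterᵇ-≤ (inHammingBall (2 * t) x) isDyck (allVecs (2 * n))))
                        (<-≤-trans (ballCount-small t q r x r≤1 q≥) 2^q≤N)
  N<2F : N < F + F
  N<2F = complement-majority inside F N (count-+-count-not (inHammingBall (2 * t) x) D) 2inside<N

nonempty-∈ : ∀ {A : Set} (xs : List A) → 0 < length xs → Σ A (_∈ xs)
nonempty-∈ (x ∷ _) _ = x , here refl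

short-walk-not-mixed : ∀ t q r → r ≤ 1 → 32 * t + 4 ≤ q → ¬ Mixed (2 * q + r) t
short-walk-not-mixed t q r r≤1 q≥ mixed =
  let x , x∈D = nonempty-∈ (DyckPaths (2 * q + r)) (≤-trans (m^n>0 2 q) (length-DyckPaths-≥ q r))
  in  ℚ.<-irrefl refl (ℚ.<-≤-trans (short-walk-far-from-uniform t q r r≤1 q≥ x) (mixed x x∈D))

n>128t⇒q≥32t+4 : ∀ n t q r → n ≡ 2 * q + r → r ≤ 1 → 17 ≤ n → 128 * t < n → 32 * t + 4 ≤ q
n>128t⇒q≥32t+4 n t q r n≡ r≤1 n≥17 n>128t = *-cancelˡ-≤ 4 (begin
  4 * (32 * t + 4)  ≡⟨ solve 1 (λ t → con 4 :* (con 32 :* t :+ con 4) := con 128 :* t :+ con 16) refl t ⟩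
  128 * t + 16      ≤⟨ +-mono-≤ (s≤s⁻¹ (≤-trans n>128t n≤)) (s≤s⁻¹ (≤-trans n≥17 n≤)) ⟩
  2 * q + 2 * q     ≡⟨ solve 1 (λ q → con 2 :* q :+ con 2 :* q := con 4 :* q) refl q ⟩
  4 * q             ∎)
  where
  open ≤-Reasoning
  n≤ : n ≤ suc (2 * q)
  n≤ = ≤-trans (≤-reflexive n≡) (≤-trans (+-monoʳ-≤ (2 * q) r≤1) (≤-reflexive (+-comm (2 * q) 1)))

mixed⇒n≤128t : ∀ n t → 17 ≤ n → Mixed n t → n ≤ 128 * t
mixed⇒n≤128t n t n≥17 mixed = decidable-stable (n ≤? 128 * t) λ n≰128t →
  subst (λ m → ¬ Mixed m t) (sym n≡)
        (short-walk-not-mixed t q r r≤1 (n>128t⇒q≥32t+4 n t q r n≡ r≤1 n≥17 (≰⇒> n≰128t)))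
        mixed
  where
  q = n ℕ./ 2
  r = n ℕ.% 2
  n≡ : n ≡ 2 * q + r
  n≡ = trans (ℕ.m≡m%n+[m/n]*n n 2) (trans (+-comm r (q * 2)) (cong (_+ r) (*-comm q 2)))
  r≤1 : r ≤ 1
  r≤1 = s≤s⁻¹ (ℕ.m%n<n n 2)

mainTheorem4 : Σ ℚ λ c → (0ℚ ℚ.< c) × Σ ℕ λ n₀ →
    ∀ n → n₀ ≤ n → ∀ t → Mixed n t → c ℚ.* (+ n / 1) ℚ.≤ (+ t / 1)
mainTheorem4 = + 1 / 128 , ℚ.positive⁻¹ _ , 17 , λ n n≥17 t mixed →
  n≤128t⇒n/128≤t n t (mixed⇒n≤128t n t n≥17 mixed)
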